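{- Let $\mathcal{F}\subseteq\mathcal{B}^{<\omega}(\mathbb{N})$ be hereditary and pointwise closed. Then every hereditary family $\mathcal{F}_1\subseteq\mathcal{F}$ is pointwise closed.
   Context: A finite disjoint collection is a tuple $(s_1,\dots,s_k)$, $k\ge0$, of nonempty finite subsets of $\mathbb{N}=\{1,2,\dots\}$ with $\max s_i<\min s_{i+1}$; $\mathcal{B}^{<\omega}(\mathbb{N})$ is the set of these; collections are identified with the set of their members. $FU(\mathbf{s})$: unions of finitely many (at least one) members of $\mathbf{s}$. $\mathcal{F}_*=\{\mathbf{t}\in\mathcal{B}^{<\omega}(\mathbb{N}):\mathbf{t}\subseteq FU(\mathbf{s})\text{ for some }\mathbf{s}\in\mathcal{F}\}\cup\{\emptyset\}$; $\mathcal{F}$ is hereditary if $\mathcal{F}_*=\mathcal{F}$. Pointwise closed: identify each collection with its characteristic function in $\{0,1\}^{[\mathbb{N}]^{<\omega}}$; a family is pointwise closed if its image is closed in the product topology. -}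

module Defs where

open import Level using (0ℓ)
open import Data.Nat using (ℕ; _≤_; _<_)
open import Data.List using (List; []; concat)
open import Data.List.Membership.Propositional using (_∈_)
open import Data.List.Relation.Unary.All using (All)
open import Data.List.Relation.Unary.Linked using (Linked)
open import Data.List.Relation.Binary.Sublist.Propositional using (_⊆_)
open import Data.Product using (Σ; ∃; _×_; proj₁)
open import Data.Sum using (_⊎_)
open import Data.Bool using (Bool; true)
open import Relation.Nullary using (¬_)
open import Relation.Binary.PropositionalEquality using (_≡_)
open import Function.Bundles using (_⇔_)
open import Relation.Unary using (Pred)

-- A finite subset of ℕ = {1,2,...} is represented canonically by the
-- strictly increasing list of its elements (all ≥ 1).
IsFinSub : List ℕ → Set
IsFinSub s = All (1 ≤_) s × Linked _<_ s

Coord : Set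
Coord = Σ (List ℕ) IsFinSub

Before : List ℕ → List ℕ → Set
Before s t = ∀ {x y} → x ∈ s → y ∈ t → x < y

-- A finite disjoint collection (s₁,…,s_k): nonempty finite subsets with
-- max sᵢ < min sᵢ₊₁.  Represented as the list of its members.
Coll : Set
Coll = List (List ℕ)

IsColl : Coll → Set
IsColl 𝐬 = All (λ s → ¬ (s ≡ []) × IsFinSub s) 𝐬 × Linked Before 𝐬

Family : Set₁
Family = Pred Coll 0ℓ

IsFamily : Family → Set
IsFamily 𝓕 = ∀ 𝐬 → 𝓕 𝐬 → IsColl 𝐬

-- t ∈ FU(𝐬): t is the union of a nonempty subcollection of 𝐬 (since the
-- members are ordered blocks, the union of a subcollection is, as an
-- increasing list, the concatenation of the corresponding sublist).
_∈FU_ : List ℕ → Coll → Set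
t ∈FU 𝐬 = ∃ λ (u : Coll) → (u ⊆ 𝐬) × ¬ (u ≡ []) × (concat u ≡ t)

_* : Family → Family
(𝓕 *) 𝐭 = (IsColl 𝐭 × ∃ λ 𝐬 → 𝓕 𝐬 × All (_∈FU 𝐬) 𝐭) ⊎ (𝐭 ≡ [])

Hereditary : Family → Set
Hereditary 𝓕 = ∀ 𝐭 → (𝓕 𝐭 → (𝓕 *) 𝐭) × ((𝓕 *) 𝐭 → 𝓕 𝐭)

Point : Set
Point = Coord → Bool

IsChar : Coll → Point → Set
IsChar 𝐬 A = ∀ (t : Coord) → (proj₁ t ∈ 𝐬) ⇔ (A t ≡ true)

Converges : (ℕ → Coll) → Point → Set
Converges seq A = ∀ (t : Coord) → ∃ λ N → ∀ n → N ≤ n →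
  (proj₁ t ∈ seq n) ⇔ (A t ≡ true)

-- Pointwise closed: the image of 𝓕 is (sequentially) closed in the product
-- topology (the space is compact metrizable, so this is closedness).
PointwiseClosed : Family → Set
PointwiseClosed 𝓕 = ∀ (seq : ℕ → Coll) → (∀ n → 𝓕 (seq n)) →
  ∀ (A : Point) → Converges seq A → ∃ λ 𝐬 → 𝓕 𝐬 × IsChar 𝐬 A

{-# OPTIONS --safe #-}
module Submission where

-- The limit A of a sequence in 𝓕₁ is, by closedness of 𝓕, the characteristic
-- function of some 𝐬 ∈ 𝓕.  Each of the finitely many members of 𝐬 is
-- eventually a member of the sequence, so some single term 𝐬_N ∈ 𝓕₁ contains
-- all of them; 𝐬 is then a subcollection of 𝐬_N and lies in 𝓕₁ because 𝓕₁ is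
-- hereditary.

open import Defs
open import Data.Nat using (ℕ; _≤_; _⊔_)
open import Data.Nat.Properties using (≤-refl; m⊔n≤o⇒m≤o; m⊔n≤o⇒n≤o)
open import Data.List using (List; []; _∷_; [_])
open import Data.List.Properties using (++-identityʳ)
open import Data.List.Membership.Propositional using (_∈_)
open import Data.List.Relation.Unary.All as All using (All; []; _∷_)
open import Data.List.Relation.Binary.Sublist.Propositional using (from∈)
open import Data.Product using (∃; _,_; proj₁; proj₂)
open import Data.Sum using (inj₁)
open import Function.Bundles using (Equivalence)

Eventually : (ℕ → Set) → Set
Eventually P = ∃ λ N → ∀ n → N ≤ n → P n

eventually-all : {B : Set} {P : ℕ → B → Set} {xs : List B} →
  All (λ x → Eventually (λ n → P n x)) xs → Eventually (λ n → All (P n) xs)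
eventually-all [] = 0 , λ _ _ → []
eventually-all ((N₁ , f) ∷ ps) with eventually-all ps
... | N₂ , g = N₁ ⊔ N₂ , λ n N≤n →
  f n (m⊔n≤o⇒m≤o N₁ N₂ N≤n) ∷ g n (m⊔n≤o⇒n≤o N₁ N₂ N≤n)

∈⇒∈FU : {t : List ℕ} {𝐬 : Coll} → t ∈ 𝐬 → t ∈FU 𝐬
∈⇒∈FU {t} t∈𝐬 = [ t ] , from∈ t∈𝐬 , (λ ()) , ++-identityʳ t

hereditary-subcollection : {𝓕 : Family} → Hereditary 𝓕 → {𝐬 𝐭 : Coll} →
  𝓕 𝐬 → IsColl 𝐭 → All (_∈ 𝐬) 𝐭 → 𝓕 𝐭
hereditary-subcollection her {𝐬} {𝐭} 𝐬∈𝓕 𝐭-coll 𝐭⊆𝐬 =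
  proj₂ (her 𝐭) (inj₁ (𝐭-coll , 𝐬 , 𝐬∈𝓕 , All.map ∈⇒∈FU 𝐭⊆𝐬))

limit-members-eventually-members : {seq : ℕ → Coll} {A : Point} {𝐬 : Coll} →
  Converges seq A → IsChar 𝐬 A → All IsFinSub 𝐬 →
  Eventually (λ n → All (_∈ seq n) 𝐬)
limit-members-eventually-members {seq} {𝐬 = 𝐬} conv char finSubs =
  eventually-all (All.tabulate member-eventually)
  where
  member-eventually : ∀ {t} → t ∈ 𝐬 → Eventually (λ n → t ∈ seq n)
  member-eventually {t} t∈𝐬 =
    let t-coord = t , All.lookup finSubs t∈𝐬
        (N , conv-t) = conv t-coord
        At = Equivalence.to (char t-coord) t∈𝐬
    in N , λ n N≤n → Equivalence.from (conv-t n N≤n) At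

corollary2p6 : (𝓕 𝓕₁ : Family) → IsFamily 𝓕 → Hereditary 𝓕 → PointwiseClosed 𝓕 →
    IsFamily 𝓕₁ → Hereditary 𝓕₁ → (∀ 𝐬 → 𝓕₁ 𝐬 → 𝓕 𝐬) → PointwiseClosed 𝓕₁
corollary2p6 _ _ 𝓕-fam _ 𝓕-closed _ 𝓕₁-her 𝓕₁⊆𝓕 seq seq∈𝓕₁ A conv
  with 𝓕-closed seq (λ n → 𝓕₁⊆𝓕 (seq n) (seq∈𝓕₁ n)) A conv
... | 𝐬 , 𝐬∈𝓕 , char
  with 𝓕-fam 𝐬 𝐬∈𝓕
... | 𝐬-coll@(members , _)
  with limit-members-eventually-members conv char (All.map proj₂ members)
... | N , 𝐬⊆seq =
  𝐬 , hereditary-subcollection 𝓕₁-her (seq∈𝓕₁ N) 𝐬-coll (𝐬⊆seq N ≤-refl) , char
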